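{- Let $k,m,n$ be nonnegative integers with $0\le k\le n\le m\le 2n$. Then $$\binom{2n}{n}\binom{n}{k}\binom{m}{k}\binom{k}{m-n}\equiv 0\pmod{\binom{2k}{k}\binom{2m-2k}{m-k}},$$ i.e. $\binom{2k}{k}\binom{2m-2k}{m-k}$ divides $\binom{2n}{n}\binom{n}{k}\binom{m}{k}\binom{k}{m-n}$. -}

module Defs where

-- If m − n > k the right-hand side vanishes.  Otherwise put j = m − n, a = k − j, b = n − k, so that
-- k = a + j, n = a + b + j and m = (a + j) + (b + j).  With X = a + j, Y = b + j, Z = a + b + j,
-- multiplying both sides by K = Z!·X!²·Y!²·a!·b!·j! turns the claim into the factorial divisibility
--   (2X)! (2Y)! Z! j! a! b!  ∣  (2Z)! (X+Y)! X! Y!.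
-- This follows from Landau's criterion: ∏ xᵢ! divides ∏ yᵢ! as soon as Σ ⌊xᵢ/q⌋ ≤ Σ ⌊yᵢ/q⌋ for
-- every q ≥ 1.  The criterion is proved from Legendre's formula for the exponent of a prime p in N!
-- (summing the hypothesis over q = p, p², …) and the fact that d ∣ n once every prime power dividing d
-- divides n.  The floor inequality needed here depends only on the residues of a, b, j modulo q, and
-- for residues it follows from monotonicity of ⌊·/q⌋ and the exchange inequality
-- ⌊2b/q⌋ + ⌊c/q⌋ ≤ ⌊2c/q⌋ + ⌊b/q⌋ for b ≤ c.
module Submission where

open import Defs
open import Data.Nat using (ℕ; _+_; _*_; _∸_; _≤_)
open import Data.Nat.Divisibility using (_∣_)
open import Data.Nat.Combinatorics using (_C_)
open import Data.Nat
open import Data.Nat.Properties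
open import Data.Nat.DivMod
open import Data.Nat.Divisibility
open import Data.Nat.Combinatorics using (nCk≡n!/k![n-k]!; k>n⇒nCk≡0; k![n∸k]!∣n!)
open import Data.Nat.Primality using (Prime; prime⇒nonZero; prime⇒nonTrivial; prime⇒irreducible; euclidsLemma)
open import Data.Nat.Primality.Factorisation using (factorise; PrimeFactorisation)
open PrimeFactorisation using (factors; isFactorisation; factorsPrime)
open import Data.Nat.Coprimality using (Coprime; coprime-divisor)
open import Data.Nat.Induction using (<-rec)
open import Data.Nat.ListAction using (sum; product)
open import Data.Nat.Tactic.RingSolver using (solve-∀)
open import Data.List using (List; []; _∷_; map)
open import Data.List.Relation.Unary.All as All using (All; []; _∷_)
open import Data.Sum using (_⊎_; inj₁; inj₂; [_,_]′)
open import Data.Product using (_×_; _,_; ∃-syntax)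
open import Data.Empty using (⊥-elim)
open import Relation.Nullary using (¬_; yes; no; contradiction)
open import Relation.Binary.PropositionalEquality
open import Algebra.Properties.CommutativeSemigroup +-commutativeSemigroup
  using () renaming (interchange to +-interchange; x∙yz≈y∙xz to +-left-comm; xy∙z≈xz∙y to +-right-comm)
open import Algebra.Properties.CommutativeSemigroup *-commutativeSemigroup
  using () renaming (interchange to *-interchange)

factorials : List ℕ → ℕ
factorials xs = product (map _! xs)

floor-sum : (q : ℕ) .{{_ : NonZero q}} → List ℕ → ℕ
floor-sum q xs = sum (map (λ x → x / q) xs)

factorials≢0 : ∀ xs → NonZero (factorials xs)
factorials≢0 []       = _
factorials≢0 (x ∷ xs) = m*n≢0 (x !) (factorials xs) {{x !≢0}} {{factorials≢0 xs}}

sum-map-+ : ∀ {A : Set} (f g : A → ℕ) xs → sum (map (λ x → f x + g x) xs) ≡ sum (map f xs) + sum (map g xs)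
sum-map-+ f g []       = refl
sum-map-+ f g (x ∷ xs) = trans (cong (f x + g x +_) (sum-map-+ f g xs))
                               (+-interchange (f x) (g x) (sum (map f xs)) (sum (map g xs)))

sum-map-0 : ∀ {A : Set} (xs : List A) → sum (map (λ _ → 0) xs) ≡ 0
sum-map-0 []       = refl
sum-map-0 (_ ∷ xs) = sum-map-0 xs

≤-sum : ∀ xs → All (_≤ sum xs) xs
≤-sum []       = []
≤-sum (x ∷ xs) = m≤m+n x (sum xs) ∷ All.map (λ y≤ → ≤-trans y≤ (m≤n+m (sum xs) x)) (≤-sum xs)

prime>1 : ∀ {p} → Prime p → 1 < p
prime>1 {p} p-prime = nonTrivial⇒n>1 p {{prime⇒nonTrivial p-prime}}

module Quotient (q : ℕ) .{{_ : NonZero q}} where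

  ⌊_⌋ : ℕ → ℕ
  ⌊ x ⌋ = x / q

  /-shift : ∀ x d → (x + d * q) / q ≡ x / q + d
  /-shift x d = trans (+-distrib-/-∣ʳ x (n∣m*n d)) (cong (x / q +_) (m*n/n≡m d q))

  +-of-splittings : ∀ r α s β → r + α * q + (s + β * q) ≡ r + s + (α + β) * q
  +-of-splittings r α s β = regroup r α s β q
    where regroup : ∀ r α s β q → r + α * q + (s + β * q) ≡ r + s + (α + β) * q
          regroup = solve-∀

  /-carry : ∀ x y → (x + y) / q ≡ x / q + y / q + (x % q + y % q) / q
  /-carry x y = begin
    (x + y) / q                                  ≡⟨ cong (_/ q) regroup ⟩
    ((x % q + y % q) + (x / q + y / q) * q) / q  ≡⟨ /-shift (x % q + y % q) (x / q + y / q) ⟩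
    (x % q + y % q) / q + (x / q + y / q)        ≡⟨ +-comm ((x % q + y % q) / q) (x / q + y / q) ⟩
    x / q + y / q + (x % q + y % q) / q          ∎
    where
    open ≡-Reasoning
    regroup : x + y ≡ (x % q + y % q) + (x / q + y / q) * q
    regroup = trans (cong₂ _+_ (m≡m%n+[m/n]*n x q) (m≡m%n+[m/n]*n y q))
                    (+-of-splittings (x % q) (x / q) (y % q) (y / q))

  -- Two residues sum to less than 2q, so the carry is at most one.
  carry≤1 : ∀ x y → (x % q + y % q) / q ≤ 1
  carry≤1 x y = <⇒≤pred (m<n*o⇒m/o<n (+-mono-< (m%n<n x q) (≤-trans (m%n<n y q) (m≤m+n q 0))))

  /-superadditive : ∀ x y → x / q + y / q ≤ (x + y) / q
  /-superadditive x y = subst (x / q + y / q ≤_) (sym (/-carry x y)) (m≤m+n _ _)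

  /-subadditive : ∀ x y → (x + y) / q ≤ x / q + y / q + 1
  /-subadditive x y = subst (_≤ x / q + y / q + 1) (sym (/-carry x y)) (+-monoʳ-≤ _ (carry≤1 x y))

  double-/ : ∀ x → ⌊ x ⌋ + ⌊ x ⌋ ≤ ⌊ 2 * x ⌋
  double-/ x = subst (λ y → ⌊ x ⌋ + ⌊ x ⌋ ≤ ⌊ y ⌋) (sym (cong (x +_) (+-identityʳ x))) (/-superadditive x x)

  /-double : ∀ x → ⌊ 2 * x ⌋ ≤ ⌊ x ⌋ + ⌊ x ⌋ + 1
  /-double x = subst (λ y → ⌊ y ⌋ ≤ ⌊ x ⌋ + ⌊ x ⌋ + 1) (sym (cong (x +_) (+-identityʳ x))) (/-subadditive x x)

  -- Exchange inequality: for b ≤ c, ⌊2b/q⌋ + ⌊c/q⌋ ≤ ⌊2c/q⌋ + ⌊b/q⌋.  If ⌊b/q⌋ = ⌊c/q⌋ this is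
  -- monotonicity; otherwise ⌊2b/q⌋ ≤ 2⌊b/q⌋ + 1 ≤ ⌊b/q⌋ + ⌊c/q⌋ and 2⌊c/q⌋ ≤ ⌊2c/q⌋.
  /-exchange : ∀ {b c} → b ≤ c → ⌊ 2 * b ⌋ + ⌊ c ⌋ ≤ ⌊ 2 * c ⌋ + ⌊ b ⌋
  /-exchange {b} {c} b≤c with m≤n⇒m<n∨m≡n (/-monoˡ-≤ q b≤c)
  ... | inj₂ ⌊b⌋≡⌊c⌋ = begin
    ⌊ 2 * b ⌋ + ⌊ c ⌋  ≡⟨ cong (⌊ 2 * b ⌋ +_) (sym ⌊b⌋≡⌊c⌋) ⟩
    ⌊ 2 * b ⌋ + ⌊ b ⌋  ≤⟨ +-monoˡ-≤ ⌊ b ⌋ (/-monoˡ-≤ q (*-monoʳ-≤ 2 b≤c)) ⟩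
    ⌊ 2 * c ⌋ + ⌊ b ⌋  ∎
    where open ≤-Reasoning
  ... | inj₁ ⌊b⌋<⌊c⌋ = begin
    ⌊ 2 * b ⌋ + ⌊ c ⌋            ≤⟨ +-monoˡ-≤ ⌊ c ⌋ (/-double b) ⟩
    ⌊ b ⌋ + ⌊ b ⌋ + 1 + ⌊ c ⌋    ≡⟨ regroup ⌊ b ⌋ ⌊ c ⌋ ⟩
    ⌊ b ⌋ + (suc ⌊ b ⌋ + ⌊ c ⌋)  ≤⟨ +-monoʳ-≤ ⌊ b ⌋ (+-monoˡ-≤ ⌊ c ⌋ ⌊b⌋<⌊c⌋) ⟩
    ⌊ b ⌋ + (⌊ c ⌋ + ⌊ c ⌋)      ≤⟨ +-monoʳ-≤ ⌊ b ⌋ (double-/ c) ⟩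
    ⌊ b ⌋ + ⌊ 2 * c ⌋            ≡⟨ +-comm ⌊ b ⌋ ⌊ 2 * c ⌋ ⟩
    ⌊ 2 * c ⌋ + ⌊ b ⌋            ∎
    where
    open ≤-Reasoning
    regroup : ∀ β γ → β + β + 1 + γ ≡ β + (suc β + γ)
    regroup = solve-∀

  -- For u ≤ v ≤ w:  ⌊2u/q⌋ + ⌊2v/q⌋ + ⌊w/q⌋ ≤ ⌊(u+v)/q⌋ + ⌊2w/q⌋ + ⌊v/q⌋,
  -- by monotonicity (2u ≤ u + v) and the exchange inequality for v ≤ w.
  /-three-terms : ∀ {u v w} → u ≤ v → v ≤ w →
                  ⌊ 2 * u ⌋ + (⌊ 2 * v ⌋ + ⌊ w ⌋) ≤ ⌊ u + v ⌋ + (⌊ 2 * w ⌋ + ⌊ v ⌋)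
  /-three-terms {u} u≤v v≤w =
    +-mono-≤ (/-monoˡ-≤ q (+-monoʳ-≤ u (≤-trans (≤-reflexive (+-identityʳ u)) u≤v))) (/-exchange v≤w)

  suc-/ : ∀ N → (q ∣ suc N × suc N / q ≡ suc (N / q)) ⊎ (¬ q ∣ suc N × suc N / q ≡ N / q)
  suc-/ N with m≤n⇒m<n∨m≡n (m%n<n N q)
  ... | inj₂ carry =
    inj₁ (divides (suc (N / q)) suc-N≡ , trans (cong (_/ q) suc-N≡) (m*n/n≡m (suc (N / q)) q))
    where
    suc-N≡ : suc N ≡ suc (N / q) * q
    suc-N≡ = trans (cong suc (m≡m%n+[m/n]*n N q)) (cong (_+ N / q * q) carry)
  ... | inj₁ no-carry = inj₂ (q∤suc-N , suc-N/q≡)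
    where
    suc-N≡ : suc N ≡ suc (N % q) + N / q * q
    suc-N≡ = cong suc (m≡m%n+[m/n]*n N q)
    suc-N/q≡ : suc N / q ≡ N / q
    suc-N/q≡ = trans (cong (_/ q) suc-N≡)
                     (trans (/-shift (suc (N % q)) (N / q)) (cong (_+ N / q) (m<n⇒m/n≡0 no-carry)))
    suc-N%q≡ : suc N % q ≡ suc (N % q)
    suc-N%q≡ = trans (cong (_% q) suc-N≡) (trans ([m+kn]%n≡m%n (suc (N % q)) (N / q) q) (m<n⇒m%n≡m no-carry))
    q∤suc-N : ¬ q ∣ suc N
    q∤suc-N q∣ = 0≢1+n (trans (sym (n∣m⇒m%n≡0 (suc N) q q∣)) suc-N%q≡)

  -- Splits x y d: x is written as y + d·q.  Such splittings are stable under sums and doubling,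
  -- and a list of them lets ⌊·/q⌋ be computed from the y's alone.
  record Splits (x y d : ℕ) : Set where
    constructor splits
    field splitting : x ≡ y + d * q

  residue+quotient : ∀ y d → Splits (y + d * q) y d
  residue+quotient y d = splits refl

  splits-+ : ∀ {x y d x′ y′ d′} → Splits x y d → Splits x′ y′ d′ → Splits (x + x′) (y + y′) (d + d′)
  splits-+ {y = y} {d} {y′ = y′} {d′} (splits refl) (splits refl) = splits (+-of-splittings y d y′ d′)

  splits-2* : ∀ {x y d} → Splits x y d → Splits (2 * x) (2 * y) (2 * d)
  splits-2* {y = y} {d} (splits refl) = splits (regroup y d q)
    where regroup : ∀ y d q → 2 * (y + d * q) ≡ 2 * y + 2 * d * q
          regroup = solve-∀

  data SplitsAll : List ℕ → List ℕ → List ℕ → Set where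
    []  : SplitsAll [] [] []
    _∷_ : ∀ {x y d xs ys ds} → Splits x y d → SplitsAll xs ys ds → SplitsAll (x ∷ xs) (y ∷ ys) (d ∷ ds)

  floor-sum-splits : ∀ {xs ys ds} → SplitsAll xs ys ds → floor-sum q xs ≡ floor-sum q ys + sum ds
  floor-sum-splits [] = refl
  floor-sum-splits {ys = y ∷ ys} {d ∷ ds} (splits refl ∷ rest) =
    trans (cong₂ _+_ (/-shift y d) (floor-sum-splits rest))
          (+-interchange (y / q) d (floor-sum q ys) (sum ds))

module Legendre (p : ℕ) (p-prime : Prime p) where
  instance
    p≢0 : NonZero p
    p≢0 = prime⇒nonZero p-prime

  record Exponent (e x : ℕ) : Set where
    constructor exponent
    field
      cofactor      : ℕ
      factorisation : x ≡ p ^ e * cofactor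
      p∤cofactor    : ¬ p ∣ cofactor

  exponent-1 : Exponent 0 1
  exponent-1 = exponent 1 refl (λ p∣1 → <⇒≢ (prime>1 p-prime) (sym (∣1⇒≡1 p∣1)))

  -- Exponents add under multiplication (Euclid's lemma keeps the cofactor prime to p).
  exponent-* : ∀ {e f x y} → Exponent e x → Exponent f y → Exponent (e + f) (x * y)
  exponent-* {e} {f} (exponent u refl p∤u) (exponent w refl p∤w) = exponent (u * w) regroup p∤uw
    where
    regroup : p ^ e * u * (p ^ f * w) ≡ p ^ (e + f) * (u * w)
    regroup = trans (*-interchange (p ^ e) u (p ^ f) w) (cong (_* (u * w)) (sym (^-distribˡ-+-* p e f)))
    p∤uw : ¬ p ∣ u * w
    p∤uw p∣uw = [ p∤u , p∤w ]′ (euclidsLemma u w p-prime p∣uw)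

  p^e∣p^v : ∀ {e v} → e ≤ v → p ^ e ∣ p ^ v
  p^e∣p^v {e} {v} e≤v = subst (λ n → p ^ e ∣ p ^ n) (m+[n∸m]≡n e≤v)
    (subst (p ^ e ∣_) (sym (^-distribˡ-+-* p e (v ∸ e))) (m∣m*n (p ^ (v ∸ e))))

  exponent-divides : ∀ {e v x} → e ≤ v → Exponent v x → p ^ e ∣ x
  exponent-divides e≤v (exponent w refl _) = ∣-trans (p^e∣p^v e≤v) (m∣m*n w)

  exponent-bound : ∀ {e v x} → Exponent v x → p ^ e ∣ x → e ≤ v
  exponent-bound {e} {v} (exponent w refl p∤w) p^e∣x with e ≤? v
  ... | yes e≤v = e≤v
  ... | no  e≰v = contradiction p∣w p∤w
    where
    v<e : v < e
    v<e = ≰⇒> e≰v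
    p^e≡ : p ^ e ≡ p ^ v * p ^ (e ∸ v)
    p^e≡ = trans (cong (p ^_) (sym (m+[n∸m]≡n (<⇒≤ v<e)))) (^-distribˡ-+-* p v (e ∸ v))
    p^[e∸v]∣w : p ^ (e ∸ v) ∣ w
    p^[e∸v]∣w = *-cancelˡ-∣ (p ^ v) {{m^n≢0 p v}} (subst (_∣ p ^ v * w) p^e≡ p^e∣x)
    p∣w : p ∣ w
    p∣w = ∣-trans (m∣m*n 1) (∣-trans (p^e∣p^v (m<n⇒0<n∸m v<e)) p^[e∸v]∣w)

  exponent-exists : ∀ x → NonZero x → ∃[ v ] Exponent v x
  exponent-exists = <-rec _ step
    where
    step : ∀ x → (∀ {y} → y < x → NonZero y → ∃[ v ] Exponent v y) → NonZero x → ∃[ v ] Exponent v x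
    step x rec x≢0 with p ∣? x
    ... | no p∤x = 0 , exponent x (sym (+-identityʳ x)) p∤x
    ... | yes (divides y refl) with rec (m<m*n y p {{y≢0}} (prime>1 p-prime)) y≢0
      where y≢0 : NonZero y
            y≢0 = m*n≢0⇒m≢0 y {{x≢0}}
    ...   | v , exponent w refl p∤w = suc v , exponent w (regroup (p ^ v) w p) p∤w
      where regroup : ∀ a w p → a * w * p ≡ p * a * w
            regroup = solve-∀

  n<p^n : ∀ n → n < p ^ n
  n<p^n zero    = s≤s z≤n
  n<p^n (suc n) = ≤-<-trans (n<p^n n)
    (subst (p ^ n <_) (*-comm (p ^ n) p) (m<m*n (p ^ n) p {{m^n≢0 p n}} (prime>1 p-prime)))

  _/p^_ : ℕ → ℕ → ℕ
  N /p^ i = (N / p ^ i) {{m^n≢0 p i}}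

  legendre : ℕ → ℕ → ℕ
  legendre zero    N = 0
  legendre (suc F) N = N /p^ suc F + legendre F N

  legendre-0 : ∀ F → legendre F 0 ≡ 0
  legendre-0 zero    = refl
  legendre-0 (suc F) = cong₂ _+_ (0/n≡0 (p ^ suc F) {{m^n≢0 p (suc F)}}) (legendre-0 F)

  -- If p ^ v exactly divides N + 1, the terms ⌊·/p^i⌋ with i ≤ v go up by one and the others stay.
  legendre-suc : ∀ F {N v} → Exponent v (suc N) → legendre F (suc N) ≡ legendre F N + F ⊓ v
  legendre-suc zero _ = refl
  legendre-suc (suc F) {N} {v} ex with Quotient.suc-/ (p ^ suc F) {{m^n≢0 p (suc F)}} N
  ... | inj₁ (p^[1+F]∣ , carry) = begin
    suc N /p^ suc F + legendre F (suc N)        ≡⟨ cong₂ _+_ carry (legendre-suc F ex) ⟩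
    suc (N /p^ suc F) + (legendre F N + F ⊓ v)
      ≡⟨ cong (λ i → suc (N /p^ suc F) + (legendre F N + i)) (m≤n⇒m⊓n≡m F≤v) ⟩
    suc (N /p^ suc F) + (legendre F N + F)      ≡⟨ regroup (N /p^ suc F) (legendre F N) F ⟩
    legendre (suc F) N + suc F                  ≡⟨ cong (legendre (suc F) N +_) (sym (m≤n⇒m⊓n≡m 1+F≤v)) ⟩
    legendre (suc F) N + suc F ⊓ v              ∎
    where
    open ≡-Reasoning
    1+F≤v : suc F ≤ v
    1+F≤v = exponent-bound ex p^[1+F]∣
    F≤v : F ≤ v
    F≤v = <⇒≤ 1+F≤v
    regroup : ∀ a b c → suc a + (b + c) ≡ a + b + suc c
    regroup = solve-∀
  ... | inj₂ (p^[1+F]∤ , no-carry) = begin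
    suc N /p^ suc F + legendre F (suc N)  ≡⟨ cong₂ _+_ no-carry (legendre-suc F ex) ⟩
    N /p^ suc F + (legendre F N + F ⊓ v)  ≡⟨ sym (+-assoc (N /p^ suc F) (legendre F N) (F ⊓ v)) ⟩
    legendre (suc F) N + F ⊓ v            ≡⟨ cong (legendre (suc F) N +_) F⊓v≡[1+F]⊓v ⟩
    legendre (suc F) N + suc F ⊓ v        ∎
    where
    open ≡-Reasoning
    v≤F : v ≤ F
    v≤F = ≮⇒≥ (λ F<v → p^[1+F]∤ (exponent-divides F<v ex))
    F⊓v≡[1+F]⊓v : F ⊓ v ≡ suc F ⊓ v
    F⊓v≡[1+F]⊓v = trans (m≥n⇒m⊓n≡n v≤F) (sym (m≥n⇒m⊓n≡n (m≤n⇒m≤1+n v≤F)))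

  -- Legendre's formula: for N ≤ F the exponent of p in N! is legendre F N.  (The exponent v of
  -- N + 1 ≤ F satisfies v < p ^ v ≤ N + 1, so the truncation at F loses nothing.)
  legendre-formula : ∀ {F} N → N ≤ F → Exponent (legendre F N) (N !)
  legendre-formula {F} zero _ = subst (λ e → Exponent e 1) (sym (legendre-0 F)) exponent-1
  legendre-formula {F} (suc N) N<F with exponent-exists (suc N) _
  ... | v , ex = subst (λ e → Exponent e (suc N !)) exponent≡ (exponent-* ex (legendre-formula N (<⇒≤ N<F)))
    where
    v≤F : v ≤ F
    v≤F = ≤-trans (<⇒≤ (n<p^n v)) (≤-trans (∣⇒≤ (exponent-divides ≤-refl ex)) N<F)
    exponent≡ : v + legendre F N ≡ legendre F (suc N)
    exponent≡ = trans (+-comm v (legendre F N))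
                      (sym (trans (legendre-suc F ex) (cong (legendre F N +_) (m≥n⇒m⊓n≡n v≤F))))

  legendre-sum : ℕ → List ℕ → ℕ
  legendre-sum F xs = sum (map (legendre F) xs)

  exponent-factorials : ∀ {F} xs → All (_≤ F) xs → Exponent (legendre-sum F xs) (factorials xs)
  exponent-factorials []       []           = exponent-1
  exponent-factorials (x ∷ xs) (x≤F ∷ xs≤F) =
    exponent-* (legendre-formula x x≤F) (exponent-factorials xs xs≤F)

  legendre-sum-mono : ∀ xs ys → (∀ q → .{{_ : NonZero q}} → floor-sum q xs ≤ floor-sum q ys) →
                      ∀ F → legendre-sum F xs ≤ legendre-sum F ys
  legendre-sum-mono xs ys _ zero = subst (_≤ legendre-sum 0 ys) (sym (sum-map-0 xs)) z≤n
  legendre-sum-mono xs ys floor-sum≤ (suc F) =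
    subst₂ _≤_ (sym (sum-map-+ (_/p^ suc F) (legendre F) xs)) (sym (sum-map-+ (_/p^ suc F) (legendre F) ys))
      (+-mono-≤ (floor-sum≤ (p ^ suc F) {{m^n≢0 p (suc F)}}) (legendre-sum-mono xs ys floor-sum≤ F))

prime∣^⇒∣ : ∀ {p q} → Prime p → ∀ e → p ∣ q ^ e → p ∣ q
prime∣^⇒∣ p-prime zero    p∣1 = ⊥-elim (<⇒≢ (prime>1 p-prime) (sym (∣1⇒≡1 p∣1)))
prime∣^⇒∣ {q = q} p-prime (suc e) p∣q^[1+e] with euclidsLemma q (q ^ e) p-prime p∣q^[1+e]
... | inj₁ p∣q   = p∣q
... | inj₂ p∣q^e = prime∣^⇒∣ p-prime e p∣q^e

coprime-prime-power : ∀ {p q} → Prime p → Prime q → q ≢ p → ∀ e → Coprime (q ^ e) p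
coprime-prime-power {p} p-prime q-prime q≢p e {d} (d∣q^e , d∣p) with prime⇒irreducible p-prime d∣p
... | inj₁ d≡1 = d≡1
... | inj₂ refl with prime⇒irreducible q-prime (prime∣^⇒∣ p-prime e d∣q^e)
...   | inj₁ p≡1 = ⊥-elim (<⇒≢ (prime>1 p-prime) (sym p≡1))
...   | inj₂ p≡q = ⊥-elim (q≢p (sym p≡q))

-- Induction on
-- the list: the first prime p divides n = p·m, and the hypothesis passes to m (cancel p when the
-- prime is p itself, use coprimality otherwise).
product-of-primes-∣ : ∀ ps → All Prime ps → ∀ n →
                      (∀ p e → Prime p → p ^ e ∣ product ps → p ^ e ∣ n) → product ps ∣ n
product-of-primes-∣ []       _                 n _ = 1∣ n
product-of-primes-∣ (p ∷ ps) (p-prime ∷ prime) n prime-powers∣ with p∣n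
  where p∣n : p ∣ n
        p∣n = subst (_∣ n) (*-identityʳ p)
                    (prime-powers∣ p 1 p-prime (subst (_∣ p * product ps) (sym (*-identityʳ p)) (m∣m*n (product ps))))
... | divides m refl =
  subst (p * product ps ∣_) (*-comm p m) (*-monoʳ-∣ p (product-of-primes-∣ ps prime m prime-powers∣m))
  where
  instance
    p≢0 : NonZero p
    p≢0 = prime⇒nonZero p-prime
  prime-powers∣m : ∀ r e → Prime r → r ^ e ∣ product ps → r ^ e ∣ m
  prime-powers∣m r e r-prime r^e∣ with r ≟ p
  ... | yes refl = *-cancelˡ-∣ p
                     (subst (p * r ^ e ∣_) (*-comm m p) (prime-powers∣ p (suc e) p-prime (*-monoʳ-∣ p r^e∣)))
  ... | no  r≢p  = coprime-divisor (coprime-prime-power p-prime r-prime r≢p e)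
                     (subst (r ^ e ∣_) (*-comm m p) (prime-powers∣ r e r-prime (∣-trans r^e∣ (n∣m*n p))))

prime-power-criterion : ∀ d n → .{{_ : NonZero d}} →
                        (∀ p e → Prime p → p ^ e ∣ d → p ^ e ∣ n) → d ∣ n
prime-power-criterion d n prime-powers∣ =
  subst (_∣ n) (sym (isFactorisation fd))
    (product-of-primes-∣ (factors fd) (factorsPrime fd) n
      (λ p e p-prime p^e∣ → prime-powers∣ p e p-prime (subst (p ^ e ∣_) (sym (isFactorisation fd)) p^e∣)))
  where fd : PrimeFactorisation d
        fd = factorise d

-- Landau's criterion: ∏ x! divides ∏ y! when Σ ⌊x/q⌋ ≤ Σ ⌊y/q⌋ for all q ≥ 1.  For a prime p, with
-- F = Σ xs + Σ ys bounding every entry, the exponent of p on the left is legendre-sum F xs, which is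
-- at most legendre-sum F ys, the exponent on the right.
landau-criterion : ∀ xs ys → (∀ q → .{{_ : NonZero q}} → floor-sum q xs ≤ floor-sum q ys) →
                   factorials xs ∣ factorials ys
landau-criterion xs ys floor-sum≤ =
  prime-power-criterion (factorials xs) (factorials ys) {{factorials≢0 xs}} prime-powers∣
  where
  F : ℕ
  F = sum xs + sum ys
  prime-powers∣ : ∀ p e → Prime p → p ^ e ∣ factorials xs → p ^ e ∣ factorials ys
  prime-powers∣ p e p-prime p^e∣ =
    exponent-divides (≤-trans (exponent-bound {e} exponent-xs p^e∣) (legendre-sum-mono xs ys floor-sum≤ F))
                     exponent-ys
    where
    open Legendre p p-prime
    exponent-xs : Exponent (legendre-sum F xs) (factorials xs)
    exponent-xs = exponent-factorials xs (All.map (λ x≤ → ≤-trans x≤ (m≤m+n (sum xs) (sum ys))) (≤-sum xs))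
    exponent-ys : Exponent (legendre-sum F ys) (factorials ys)
    exponent-ys = exponent-factorials ys (All.map (λ y≤ → ≤-trans y≤ (m≤n+m (sum ys) (sum xs))) (≤-sum ys))

-- The factorials of the cleared lemma, with X = a + j, Y = b + j, Z = a + b + j:
-- den = (2X)! (2Y)! Z! j! a! b!  and  num = (2Z)! (X+Y)! X! Y!.
den num : ℕ → ℕ → ℕ → List ℕ
den a b j = 2 * (a + j) ∷ 2 * (b + j) ∷ a + b + j ∷ j ∷ a ∷ b ∷ []
num a b j = 2 * (a + b + j) ∷ (a + j) + (b + j) ∷ a + j ∷ b + j ∷ []

module DenNumInequality (q : ℕ) .{{_ : NonZero q}} where
  open Quotient q

  -- The inequality without the terms ⌊a/q⌋, ⌊b/q⌋, ⌊j/q⌋.  By symmetry in (r, s) assume r ≤ s; then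
  -- /-three-terms with u = r + t, v = s + t, w = r + s + t applies, and ⌊u/q⌋ ≥ 0 is spare.
  core-inequality : ∀ r s t →
    ⌊ 2 * (r + t) ⌋ + (⌊ 2 * (s + t) ⌋ + ⌊ r + s + t ⌋)
      ≤ ⌊ 2 * (r + s + t) ⌋ + (⌊ (r + t) + (s + t) ⌋ + (⌊ r + t ⌋ + ⌊ s + t ⌋))
  core-inequality r s t with ≤-total r s
  ... | inj₁ r≤s = begin
    ⌊ 2 * u ⌋ + (⌊ 2 * v ⌋ + ⌊ w ⌋)        ≤⟨ /-three-terms (+-monoˡ-≤ t r≤s) (+-monoˡ-≤ t (m≤n+m s r)) ⟩
    ⌊ u + v ⌋ + (⌊ 2 * w ⌋ + ⌊ v ⌋)        ≡⟨ +-left-comm ⌊ u + v ⌋ ⌊ 2 * w ⌋ ⌊ v ⌋ ⟩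
    ⌊ 2 * w ⌋ + (⌊ u + v ⌋ + ⌊ v ⌋)        ≤⟨ +-monoʳ-≤ ⌊ 2 * w ⌋ (+-monoʳ-≤ ⌊ u + v ⌋ (m≤n+m ⌊ v ⌋ ⌊ u ⌋)) ⟩
    ⌊ 2 * w ⌋ + (⌊ u + v ⌋ + (⌊ u ⌋ + ⌊ v ⌋))  ∎
    where
    open ≤-Reasoning
    u v w : ℕ
    u = r + t
    v = s + t
    w = r + s + t
  ... | inj₂ s≤r = begin
    ⌊ 2 * u ⌋ + (⌊ 2 * v ⌋ + ⌊ w ⌋)        ≡⟨ +-left-comm ⌊ 2 * u ⌋ ⌊ 2 * v ⌋ ⌊ w ⌋ ⟩
    ⌊ 2 * v ⌋ + (⌊ 2 * u ⌋ + ⌊ w ⌋)        ≤⟨ /-three-terms (+-monoˡ-≤ t s≤r) (+-monoˡ-≤ t (m≤m+n r s)) ⟩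
    ⌊ v + u ⌋ + (⌊ 2 * w ⌋ + ⌊ u ⌋)        ≡⟨ cong (λ x → ⌊ x ⌋ + (⌊ 2 * w ⌋ + ⌊ u ⌋)) (+-comm v u) ⟩
    ⌊ u + v ⌋ + (⌊ 2 * w ⌋ + ⌊ u ⌋)        ≡⟨ +-left-comm ⌊ u + v ⌋ ⌊ 2 * w ⌋ ⌊ u ⌋ ⟩
    ⌊ 2 * w ⌋ + (⌊ u + v ⌋ + ⌊ u ⌋)        ≤⟨ +-monoʳ-≤ ⌊ 2 * w ⌋ (+-monoʳ-≤ ⌊ u + v ⌋ (m≤m+n ⌊ u ⌋ ⌊ v ⌋)) ⟩
    ⌊ 2 * w ⌋ + (⌊ u + v ⌋ + (⌊ u ⌋ + ⌊ v ⌋))  ∎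
    where
    open ≤-Reasoning
    u v w : ℕ
    u = r + t
    v = s + t
    w = r + s + t

  residue-inequality : ∀ {r s t} → r < q → s < q → t < q → floor-sum q (den r s t) ≤ floor-sum q (num r s t)
  residue-inequality {r} {s} {t} r<q s<q t<q = begin
    floor-sum q (den r s t)
      ≡⟨ cong (λ z → ⌊ 2 * u ⌋ + (⌊ 2 * v ⌋ + (⌊ w ⌋ + z))) residues-vanish ⟩
    ⌊ 2 * u ⌋ + (⌊ 2 * v ⌋ + (⌊ w ⌋ + 0))
      ≡⟨ cong (λ z → ⌊ 2 * u ⌋ + (⌊ 2 * v ⌋ + z)) (+-identityʳ ⌊ w ⌋) ⟩
    ⌊ 2 * u ⌋ + (⌊ 2 * v ⌋ + ⌊ w ⌋)
      ≤⟨ core-inequality r s t ⟩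
    ⌊ 2 * w ⌋ + (⌊ u + v ⌋ + (⌊ u ⌋ + ⌊ v ⌋))
      ≡⟨ cong (λ z → ⌊ 2 * w ⌋ + (⌊ u + v ⌋ + (⌊ u ⌋ + z))) (sym (+-identityʳ ⌊ v ⌋)) ⟩
    floor-sum q (num r s t)  ∎
    where
    open ≤-Reasoning
    u v w : ℕ
    u = r + t
    v = s + t
    w = r + s + t
    residues-vanish : ⌊ t ⌋ + (⌊ r ⌋ + (⌊ s ⌋ + 0)) ≡ 0
    residues-vanish rewrite m<n⇒m/n≡0 t<q | m<n⇒m/n≡0 r<q | m<n⇒m/n≡0 s<q = refl

  den-splits : ∀ r s t α β γ →
    floor-sum q (den (r + α * q) (s + β * q) (t + γ * q)) ≡ floor-sum q (den r s t) + sum (den α β γ)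
  den-splits r s t α β γ = floor-sum-splits
    (splits-2* (splits-+ a j) ∷ splits-2* (splits-+ b j) ∷ splits-+ (splits-+ a b) j ∷ j ∷ a ∷ b ∷ [])
    where a : Splits (r + α * q) r α
          a = residue+quotient r α
          b : Splits (s + β * q) s β
          b = residue+quotient s β
          j : Splits (t + γ * q) t γ
          j = residue+quotient t γ

  num-splits : ∀ r s t α β γ →
    floor-sum q (num (r + α * q) (s + β * q) (t + γ * q)) ≡ floor-sum q (num r s t) + sum (num α β γ)
  num-splits r s t α β γ = floor-sum-splits
    (splits-2* (splits-+ (splits-+ a b) j) ∷ splits-+ (splits-+ a j) (splits-+ b j)
      ∷ splits-+ a j ∷ splits-+ b j ∷ [])
    where a : Splits (r + α * q) r α
          a = residue+quotient r α
          b : Splits (s + β * q) s β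
          b = residue+quotient s β
          j : Splits (t + γ * q) t γ
          j = residue+quotient t γ

  balanced : ∀ α β γ → sum (den α β γ) ≡ sum (num α β γ)
  balanced α β γ = sums-agree α β γ
    where
    sums-agree : ∀ α β γ → 2 * (α + γ) + (2 * (β + γ) + (α + β + γ + (γ + (α + (β + 0)))))
                         ≡ 2 * (α + β + γ) + ((α + γ) + (β + γ) + ((α + γ) + ((β + γ) + 0)))
    sums-agree = solve-∀

  residue-reduction : ∀ {a b j} r s t α β γ → r < q → s < q → t < q →
                      a ≡ r + α * q → b ≡ s + β * q → j ≡ t + γ * q →
                      floor-sum q (den a b j) ≤ floor-sum q (num a b j)
  residue-reduction r s t α β γ r<q s<q t<q refl refl refl = begin
    floor-sum q (den (r + α * q) (s + β * q) (t + γ * q))  ≡⟨ den-splits r s t α β γ ⟩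
    floor-sum q (den r s t) + sum (den α β γ)
      ≤⟨ +-mono-≤ (residue-inequality r<q s<q t<q) (≤-reflexive (balanced α β γ)) ⟩
    floor-sum q (num r s t) + sum (num α β γ)              ≡⟨ sym (num-splits r s t α β γ) ⟩
    floor-sum q (num (r + α * q) (s + β * q) (t + γ * q))  ∎
    where open ≤-Reasoning

  floor-inequality : ∀ a b j → floor-sum q (den a b j) ≤ floor-sum q (num a b j)
  floor-inequality a b j = residue-reduction (a % q) (b % q) (j % q) (a / q) (b / q) (j / q)
    (m%n<n a q) (m%n<n b q) (m%n<n j q) (m≡m%n+[m/n]*n a q) (m≡m%n+[m/n]*n b q) (m≡m%n+[m/n]*n j q)

binomial-factorials : ∀ {n k r} → k ≤ n → n ∸ k ≡ r → (n C k) * (k ! * r !) ≡ n !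
binomial-factorials {n} {k} k≤n refl =
  trans (cong (_* (k ! * (n ∸ k) !)) (nCk≡n!/k![n-k]! k≤n)) (m/n*n≡m {{k !* (n ∸ k) !≢0}} (k![n∸k]!∣n! k≤n))

central-binomial-factorials : ∀ n → ((2 * n) C n) * (n ! * n !) ≡ (2 * n) !
central-binomial-factorials n = binomial-factorials (m≤m+n n (n + 0)) (trans (m+n∸m≡n n (n + 0)) (+-identityʳ n))

-- The lemma in the variables a, b, j: multiply both sides by K = Z!·X!²·Y!²·a!·b!·j!, which turns
-- them into the two lists of factorials of Landau's criterion, and cancel K.
central-divisibility : ∀ a b j →
  ((2 * (a + j)) C (a + j)) * ((2 * (b + j)) C (b + j))
    ∣ ((2 * (a + b + j)) C (a + b + j)) * ((a + b + j) C (a + j)) * (((a + j) + (b + j)) C (a + j)) * ((a + j) C j)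
central-divisibility a b j =
  *-cancelʳ-∣ K {{factorials≢0 K-list}} (subst₂ _∣_ (sym lhs*K) (sym rhs*K)
    (landau-criterion (den a b j) (num a b j) (λ q → DenNumInequality.floor-inequality q a b j)))
  where
  X Y Z : ℕ
  X = a + j
  Y = b + j
  Z = a + b + j
  K-list : List ℕ
  K-list = Z ∷ X ∷ X ∷ Y ∷ Y ∷ a ∷ b ∷ j ∷ []
  K : ℕ
  K = factorials K-list
  lhs*K : ((2 * X) C X) * ((2 * Y) C Y) * K ≡ factorials (den a b j)
  lhs*K = begin
    ((2 * X) C X) * ((2 * Y) C Y) * K
      ≡⟨ regroup ((2 * X) C X) ((2 * Y) C Y) (Z !) (X !) (Y !) (a !) (b !) (j !) ⟩
    ((2 * X) C X) * (X ! * X !) * (((2 * Y) C Y) * (Y ! * Y !) * (Z ! * (j ! * (a ! * (b ! * 1)))))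
      ≡⟨ cong₂ (λ u v → u * (v * (Z ! * (j ! * (a ! * (b ! * 1))))))
               (central-binomial-factorials X) (central-binomial-factorials Y) ⟩
    factorials (den a b j) ∎
    where
    open ≡-Reasoning
    regroup : ∀ c₁ c₂ z x y a b j → c₁ * c₂ * (z * (x * (x * (y * (y * (a * (b * (j * 1))))))))
                                  ≡ c₁ * (x * x) * (c₂ * (y * y) * (z * (j * (a * (b * 1)))))
    regroup = solve-∀
  rhs*K : ((2 * Z) C Z) * (Z C X) * ((X + Y) C X) * (X C j) * K ≡ factorials (num a b j)
  rhs*K = begin
    ((2 * Z) C Z) * (Z C X) * ((X + Y) C X) * (X C j) * K
      ≡⟨ regroup ((2 * Z) C Z) (Z C X) ((X + Y) C X) (X C j) (Z !) (X !) (Y !) (a !) (b !) (j !) ⟩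
    ((2 * Z) C Z) * (Z ! * ((Z C X) * (X ! * b !))) * (((X + Y) C X) * (X ! * Y !) * ((X C j) * (j ! * a !) * (Y ! * 1)))
      ≡⟨ cong (λ u → ((2 * Z) C Z) * (Z ! * u) * (((X + Y) C X) * (X ! * Y !) * ((X C j) * (j ! * a !) * (Y ! * 1))))
              (binomial-factorials X≤Z Z∸X≡b) ⟩
    ((2 * Z) C Z) * (Z ! * Z !) * (((X + Y) C X) * (X ! * Y !) * ((X C j) * (j ! * a !) * (Y ! * 1)))
      ≡⟨ cong₂ _*_ (central-binomial-factorials Z)
               (cong₂ (λ u v → u * (v * (Y ! * 1))) (binomial-factorials (m≤m+n X Y) (m+n∸m≡n X Y))
                                                     (binomial-factorials (m≤n+m j a) (m+n∸n≡m a j))) ⟩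
    factorials (num a b j) ∎
    where
    open ≡-Reasoning
    X≤Z : X ≤ Z
    X≤Z = +-monoˡ-≤ j (m≤m+n a b)
    Z∸X≡b : Z ∸ X ≡ b
    Z∸X≡b = trans (cong (_∸ X) (+-right-comm a b j)) (m+n∸m≡n X b)
    regroup : ∀ c₁ c₂ c₃ c₄ z x y a b j →
      c₁ * c₂ * c₃ * c₄ * (z * (x * (x * (y * (y * (a * (b * (j * 1))))))))
        ≡ c₁ * (z * (c₂ * (x * b))) * (c₃ * (x * y) * (c₄ * (j * a) * (y * 1)))
    regroup = solve-∀

2[x+y]∸2x≡2y : ∀ x y → 2 * (x + y) ∸ 2 * x ≡ 2 * y
2[x+y]∸2x≡2y x y = trans (cong (_∸ 2 * x) (*-distribˡ-+ 2 x y)) (m+n∸m≡n (2 * x) (2 * y))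

[a+j]+[b+j]∸[a+b+j]≡j : ∀ a b j → (a + j) + (b + j) ∸ (a + b + j) ≡ j
[a+j]+[b+j]∸[a+b+j]≡j a b j = trans (cong (_∸ (a + b + j)) (regroup a b j)) (m+n∸m≡n (a + b + j) j)
  where regroup : ∀ a b j → (a + j) + (b + j) ≡ (a + b + j) + j
        regroup = solve-∀

central-form : ∀ {k m n} a b j → a + j ≡ k → a + b + j ≡ n → (a + j) + (b + j) ≡ m →
  ((2 * k) C k) * ((2 * m ∸ 2 * k) C (m ∸ k)) ∣ ((2 * n) C n) * (n C k) * (m C k) * (k C (m ∸ n))
central-form a b j refl refl refl =
  reshape (sym (2[x+y]∸2x≡2y X Y)) (sym (m+n∸m≡n X Y)) (sym ([a+j]+[b+j]∸[a+b+j]≡j a b j))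
    (central-divisibility a b j)
  where
  X Y Z : ℕ
  X = a + j
  Y = b + j
  Z = a + b + j
  Shape : ℕ → ℕ → ℕ → Set
  Shape u v w = ((2 * X) C X) * (u C v) ∣ ((2 * Z) C Z) * (Z C X) * ((X + Y) C X) * (X C w)
  reshape : ∀ {u v w u′ v′ w′} → u ≡ u′ → v ≡ v′ → w ≡ w′ → Shape u v w → Shape u′ v′ w′
  reshape refl refl refl s = s

-- If m − n > k then C(k, m − n) = 0 and there is nothing to prove; otherwise the parameters
-- a = k − j, b = n − k, j = m − n bring the lemma to central-form.
lemma2p1 : (k m n : ℕ) → k ≤ n → n ≤ m → m ≤ 2 * n →
    ((2 * k) C k) * ((2 * m ∸ 2 * k) C (m ∸ k))
      ∣ ((2 * n) C n) * (n C k) * (m C k) * (k C (m ∸ n))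
lemma2p1 k m n k≤n n≤m _ with m ∸ n ≤? k
... | no m∸n≰k = subst (((2 * k) C k) * ((2 * m ∸ 2 * k) C (m ∸ k)) ∣_) (sym rhs≡0) (_ ∣0)
  where
  rhs≡0 : ((2 * n) C n) * (n C k) * (m C k) * (k C (m ∸ n)) ≡ 0
  rhs≡0 = trans (cong (((2 * n) C n) * (n C k) * (m C k) *_) (k>n⇒nCk≡0 (≰⇒> m∸n≰k)))
                (*-zeroʳ (((2 * n) C n) * (n C k) * (m C k)))
... | yes m∸n≤k =
  central-form (k ∸ j) (n ∸ k) j a+j≡k a+b+j≡n (trans (cong (_+ (n ∸ k + j)) a+j≡k) k+[b+j]≡m)
  where
  j : ℕ
  j = m ∸ n
  a+j≡k : k ∸ j + j ≡ k
  a+j≡k = m∸n+n≡m m∸n≤k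
  a+b+j≡n : k ∸ j + (n ∸ k) + j ≡ n
  a+b+j≡n = trans (+-right-comm (k ∸ j) (n ∸ k) j) (trans (cong (_+ (n ∸ k)) a+j≡k) (m+[n∸m]≡n k≤n))
  k+[b+j]≡m : k + (n ∸ k + j) ≡ m
  k+[b+j]≡m = trans (sym (+-assoc k (n ∸ k) j)) (trans (cong (_+ j) (m+[n∸m]≡n k≤n)) (m+[n∸m]≡n n≤m))
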